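{- Let $\mathcal{G}$ be a hereditary family of finite undirected graphs (closed under taking induced subgraphs). If the algorithm TSS is optimal for $\mathcal{G}$, then the algorithm MTS is optimal for $\mathcal{G}$. Here an algorithm is optimal for $\mathcal{G}$ if, for every $G=(V,E)\in\mathcal{G}$ and every threshold function $t:V\to\mathbb{N}$, it returns (in every execution) a minimum-size target set for $G$ with thresholds $t$.
   Context: Graphs are finite, without loops; $\Gamma(v)$ is the neighborhood in an undirected graph. An undirected graph is treated as the bidirected digraph in which each edge $\{u,v\}$ is replaced by the two arcs $(u,v),(v,u)$, so $\Gamma^{in}(v)=\Gamma^{out}(v)=\Gamma(v)$. Given thresholds $t:V\to\mathbb{N}=\{0,1,2,\dots\}$ and $S\subseteq V$, the activation process starting at $S$ is $A_0=S$ and $A_\ell=A_{\ell-1}\cup\{u\in V: |\Gamma(u)\cap A_{\ell-1}|\ge t(u)\}$ for $\ell\ge1$. $S$ is a target set for $(G,t)$ if $A_\lambda=V$ for some $\lambda\ge0$. Algorithm MTS on input $(G,t)$: set $S=\emptyset$, $L=\emptyset$, $U=V$, and for each $v\in V$ set $k(v)=t(v)$, $\delta(v)=|\Gamma^{in}(v)|$. While $U\neq\emptyset$, perform one iteration as follows. Case 1: if some $v\in U$ has $k(v)=0$, select such a $v$; for each $u\in\Gamma^{out}(v)\cap U$ set $k(u)=\max(k(u)-1,0)$ and, if $v\notin L$, set $\delta(u)=\delta(u)-1$; then set $U=U\setminus\{v\}$. Case 2: otherwise, if some $v\in U\setminus L$ has $\delta(v)<k(v)$, select such a $v$; set $S=S\cup\{v\}$;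 for each $u\in\Gamma^{out}(v)\cap U$ set $k(u)=k(u)-1$ and $\delta(u)=\delta(u)-1$; then set $U=U\setminus\{v\}$. Case 3: otherwise, select $v\in U\setminus L$ maximizing $\frac{k(u)}{\delta(u)(\delta(u)+1)}$ over $u\in U\setminus L$; for each $u\in\Gamma^{out}(v)\cap U$ set $\delta(u)=\delta(u)-1$; set $L=L\cup\{v\}$. When $U=\emptyset$, return $S$. Algorithm TSS on input $(G,t)$ ($G$ undirected): set $S=\emptyset$, $U=V$, and for each $v$ set $k(v)=t(v)$, $\delta(v)=|\Gamma(v)|$. While $U\neq\emptyset$: Case 1: if some $v\in U$ has $k(v)=0$, select such $v$ and for each $u\in\Gamma(v)\cap U$ set $k(u)=\max(k(u)-1,0)$; Case 2: otherwise, if some $v\in U$ has $\delta(v)<k(v)$, select such $v$, set $S=S\cup\{v\}$, and for each $u\in\Gamma(v)\cap U$ set $k(u)=k(u)-1$; Case 3: otherwise select $v\in U$ maximizing $\frac{k(u)}{\delta(u)(\delta(u)+1)}$ over $u\in U$. In all three cases, then for each $u\in\Gamma(v)\cap U$ set $\delta(u)=\delta(u)-1$, and set $U=U\setminus\{v\}$. When $U=\emptyset$, return $S$. In both algorithms, whenever several nodes qualify in a case, one of them is chosen arbitrarily. -}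

module Defs where

open import Data.Bool using (Bool; true; false; _∧_; _∨_; not; if_then_else_)
open import Data.Nat using (ℕ; zero; suc; _+_; _*_; _∸_; _≤_; _<_; _≤ᵇ_)
open import Data.Fin using (Fin)
open import Data.Fin.Properties using (_≟_)
open import Data.List using (List; map; allFin)
open import Data.Nat.ListAction using (sum)
open import Data.Product using (Σ; ∃; _×_)
open import Function.Definitions using (Injective)
open import Relation.Nullary using (does; ¬_)
open import Relation.Binary.PropositionalEquality using (_≡_)
open import Relation.Binary.Construct.Closure.ReflexiveTransitive using (Star)

record Graph : Set where
  field
    n      : ℕ
    adj    : Fin n → Fin n → Bool
    sym    : ∀ i j → adj i j ≡ adj j i
    irrefl : ∀ i → adj i i ≡ false
open Graph public

Subset : ℕ → Set
Subset n = Fin n → Bool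

card : ∀ {n} → Subset n → ℕ
card {n} A = sum (map (λ i → if A i then 1 else 0) (allFin n))

nbrCount : (G : Graph) → Fin (n G) → Subset (n G) → ℕ
nbrCount G u A = card (λ w → adj G u w ∧ A w)

deg : (G : Graph) → Fin (n G) → ℕ
deg G v = card (adj G v)

actStep : (G : Graph) → (Fin (n G) → ℕ) → Subset (n G) → Subset (n G)
actStep G t A u = A u ∨ (t u ≤ᵇ nbrCount G u A)

activated : (G : Graph) → (Fin (n G) → ℕ) → Subset (n G) → ℕ → Subset (n G)
activated G t S zero    = S
activated G t S (suc ℓ) = actStep G t (activated G t S ℓ)

IsTargetSet : (G : Graph) → (Fin (n G) → ℕ) → Subset (n G) → Set
IsTargetSet G t S = ∃ λ ℓ → ∀ v → activated G t S ℓ v ≡ true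

IsMinTargetSet : (G : Graph) → (Fin (n G) → ℕ) → Subset (n G) → Set
IsMinTargetSet G t S =
  IsTargetSet G t S × (∀ S′ → IsTargetSet G t S′ → card S ≤ card S′)

InducedSubgraph : Graph → Graph → Set
InducedSubgraph H G =
  Σ (Fin (n H) → Fin (n G)) λ f →
    Injective _≡_ _≡_ f × (∀ i j → adj H i j ≡ adj G (f i) (f j))

Hereditary : (Graph → Set) → Set
Hereditary 𝒢 = ∀ G H → 𝒢 G → InducedSubgraph H G → 𝒢 H

remove : ∀ {n} → Subset n → Fin n → Subset n
remove U v u = if does (u ≟ v) then false else U u

insert : ∀ {n} → Subset n → Fin n → Subset n
insert S v u = if does (u ≟ v) then true else S u

decAt : (G : Graph) → Subset (n G) → Fin (n G) → Bool →
        (Fin (n G) → ℕ) → (Fin (n G) → ℕ)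
decAt G U v b f u = if adj G v u ∧ U u ∧ b then f u ∸ 1 else f u

record MState (m : ℕ) : Set where
  constructor mstate
  field
    S L U : Subset m
    k δ   : Fin m → ℕ
open MState public

mInit : (G : Graph) → (Fin (n G) → ℕ) → MState (n G)
mInit G t = mstate (λ _ → false) (λ _ → false) (λ _ → true) t (deg G)

NoCase1 : ∀ {m} → MState m → Set
NoCase1 st = ∀ w → U st w ≡ true → ¬ (k st w ≡ 0)

data MStep (G : Graph) : MState (n G) → MState (n G) → Set where
  case1 : ∀ {S L U k δ} v → U v ≡ true → k v ≡ 0 →
    MStep G (mstate S L U k δ)
            (mstate S L (remove U v) (decAt G U v true k)
                    (decAt G U v (not (L v)) δ))
  case2 : ∀ {S L U k δ} v →
    NoCase1 (mstate S L U k δ) →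
    U v ≡ true → L v ≡ false → δ v < k v →
    MStep G (mstate S L U k δ)
            (mstate (insert S v) L (remove U v) (decAt G U v true k)
                    (decAt G U v true δ))
  case3 : ∀ {S L U k δ} v →
    NoCase1 (mstate S L U k δ) →
    (∀ w → U w ≡ true → L w ≡ false → k w ≤ δ w) →
    U v ≡ true → L v ≡ false →
    -- v maximises k(u)/(δ(u)(δ(u)+1)) over U \ L (cross-multiplied;
    -- here all δ(u) ≥ k(u) ≥ 1)
    (∀ u → U u ≡ true → L u ≡ false →
       k u * (δ v * suc (δ v)) ≤ k v * (δ u * suc (δ u))) →
    MStep G (mstate S L U k δ)
            (mstate S (insert L v) U k (decAt G U v true δ))

MTSOptimalOn : (G : Graph) → (Fin (n G) → ℕ) → Set
MTSOptimalOn G t = ∀ fin → Star (MStep G) (mInit G t) fin →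
  (∀ v → U fin v ≡ false) → IsMinTargetSet G t (S fin)

MTSOptimal : (Graph → Set) → Set
MTSOptimal 𝒢 = ∀ G → 𝒢 G → (t : Fin (n G) → ℕ) → MTSOptimalOn G t

record TState (m : ℕ) : Set where
  constructor tstate
  field
    tS tU : Subset m
    tk tδ : Fin m → ℕ
open TState public

tInit : (G : Graph) → (Fin (n G) → ℕ) → TState (n G)
tInit G t = tstate (λ _ → false) (λ _ → true) t (deg G)

TNoCase1 : ∀ {m} → TState m → Set
TNoCase1 st = ∀ w → tU st w ≡ true → ¬ (tk st w ≡ 0)

data TStep (G : Graph) : TState (n G) → TState (n G) → Set where
  case1 : ∀ {S U k δ} v → U v ≡ true → k v ≡ 0 →
    TStep G (tstate S U k δ)
            (tstate S (remove U v) (decAt G U v true k) (decAt G U v true δ))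
  case2 : ∀ {S U k δ} v →
    TNoCase1 (tstate S U k δ) →
    U v ≡ true → δ v < k v →
    TStep G (tstate S U k δ)
            (tstate (insert S v) (remove U v) (decAt G U v true k)
                    (decAt G U v true δ))
  case3 : ∀ {S U k δ} v →
    TNoCase1 (tstate S U k δ) →
    (∀ w → U w ≡ true → k w ≤ δ w) →
    U v ≡ true →
    (∀ u → U u ≡ true →
       k u * (δ v * suc (δ v)) ≤ k v * (δ u * suc (δ u))) →
    TStep G (tstate S U k δ)
            (tstate S (remove U v) k (decAt G U v true δ))

TSSOptimalOn : (G : Graph) → (Fin (n G) → ℕ) → Set
TSSOptimalOn G t = ∀ fin → Star (TStep G) (tInit G t) fin →
  (∀ v → tU fin v ≡ false) → IsMinTargetSet G t (tS fin)

TSSOptimal : (Graph → Set) → Set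
TSSOptimal 𝒢 = ∀ G → 𝒢 G → (t : Fin (n G) → ℕ) → TSSOptimalOn G t

-- MTS keeps track of the subgraph H of G induced on the undecided vertices U ∖ L (δ is its degree function,
-- k the residual thresholds) with the invariant that every vertex removed from U is activated by S and that
-- every target set T of (G, t) yields a target set T′ of (H, k) with |S| + |T′| ≤ |T|. Cases 1 and 2 delete a
-- vertex v from H: a target set of H restricts to one of H − v, and in Case 2 the vertex v has fewer neighbours
-- than its threshold, so it lies in every target set of H and is paid for by S. Case 3 deletes the
-- ratio-maximising v from H without changing k. This is where the hypothesis enters: H and H − v are induced
-- subgraphs of G, hence in 𝒢, and TSS on (H, k) may start with the very same Case 3 step at v and then runs
-- exactly as TSS on (H − v, k); optimality of TSS on both shows that (H − v, k) needs no more seeds than (H, k).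
-- When U is empty, H is empty and |S| ≤ |T|.

module Submission where

open import Defs renaming (sym to adj-sym)
open import Algebra.Properties.CommutativeSemigroup using (xy∙z≈xz∙y; x∙yz≈y∙xz; xy∙z≈y∙xz)
import Data.Bool as Bool
open import Data.Bool using (Bool; true; false; _∧_; _∨_; not; if_then_else_)
open import Data.Bool.Properties using (T-≡; ∧-identityʳ; ∧-zeroʳ; ∨-zeroʳ)
open import Data.Empty using (⊥; ⊥-elim)
open import Data.Fin using (Fin; zero; suc; punchIn; punchOut)
open import Data.Fin.Properties using (any?; _≟_; punchInᵢ≢i; punchIn-injective; punchIn-punchOut)
open import Data.List using (allFin)
open import Data.List.Properties using (map-tabulate; map-cong)
import Data.Nat as ℕ
open import Data.Nat using (_<?_; ℕ; zero; suc; pred; _+_; _*_; _∸_; _≤_; _<_; z≤n; NonZero)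
open import Data.Nat.ListAction using (sum)
open import Data.Nat.Properties
  using (≤-refl; ≤-reflexive; ≤-trans; ≤-total; <⇒≱; ≮⇒≥; ≤ᵇ⇒≤; ≤⇒≤ᵇ; n≤0⇒n≡0; suc-injective;
         +-mono-≤; +-monoˡ-≤; +-monoʳ-≤; +-suc; m≤m+n; m≤n+m; m≤n+m∸n; m+n∸m≡n; m∸n≤m; ∸-monoˡ-≤;
         *-cancelʳ-≤; *-monoˡ-≤; +-commutativeSemigroup; *-commutativeSemigroup; module ≤-Reasoning)
open import Data.Product using (∃; _×_; _,_; proj₁; proj₂)
open import Data.Sum using (_⊎_; inj₁; inj₂; reduce)
open import Function using (_∘_; id; Equivalence)
open import Function.Definitions using (Injective)
open import Relation.Nullary using (yes; no; contradiction)
open import Relation.Nullary.Decidable using (_×-dec_)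
open import Relation.Binary.PropositionalEquality
open import Relation.Binary.Construct.Closure.ReflexiveTransitive using (Star; ε; _◅_)

toℕ : Bool → ℕ
toℕ b = if b then 1 else 0

_⊆_ : ∀ {m} → Subset m → Subset m → Set
A ⊆ B = ∀ i → A i ≡ true → B i ≡ true

card-cong : ∀ {m} {A B : Subset m} → (∀ i → A i ≡ B i) → card A ≡ card B
card-cong {m} A≗B = cong sum (map-cong (cong toℕ ∘ A≗B) (allFin m))

card-suc : ∀ {m} (A : Subset (suc m)) → card A ≡ toℕ (A zero) + card (A ∘ suc)
card-suc A = cong (λ xs → toℕ (A zero) + sum xs)
  (trans (map-tabulate suc (toℕ ∘ A)) (sym (map-tabulate id (toℕ ∘ A ∘ suc))))

toℕ-mono : ∀ {a b} → (a ≡ true → b ≡ true) → toℕ a ≤ toℕ b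
toℕ-mono {false} _ = z≤n
toℕ-mono {true} a⇒b rewrite a⇒b refl = ≤-refl

card-mono : ∀ {m} {A B : Subset m} → A ⊆ B → card A ≤ card B
card-mono {zero} _ = z≤n
card-mono {suc m} {A} {B} A⊆B = begin
  card A                            ≡⟨ card-suc A ⟩
  toℕ (A zero) + card (A ∘ suc)     ≤⟨ +-mono-≤ (toℕ-mono (A⊆B zero)) (card-mono (A⊆B ∘ suc)) ⟩
  toℕ (B zero) + card (B ∘ suc)     ≡⟨ card-suc B ⟨
  card B                            ∎
  where open ≤-Reasoning

card-punchIn : ∀ {m} (A : Subset (suc m)) i → card A ≡ toℕ (A i) + card (A ∘ punchIn i)
card-punchIn A zero = card-suc A
card-punchIn {suc m} A (suc i) = begin
  card A
    ≡⟨ card-suc A ⟩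
  a₀ + card (A ∘ suc)
    ≡⟨ cong (a₀ +_) (card-punchIn (A ∘ suc) i) ⟩
  a₀ + (aᵢ + card (A ∘ suc ∘ punchIn i))
    ≡⟨ x∙yz≈y∙xz +-commutativeSemigroup a₀ aᵢ _ ⟩
  aᵢ + (a₀ + card (A ∘ suc ∘ punchIn i))
    ≡⟨ cong (aᵢ +_) (card-suc (A ∘ punchIn (suc i))) ⟨
  aᵢ + card (A ∘ punchIn (suc i))
    ∎
  where
  open ≡-Reasoning
  a₀ = toℕ (A zero)
  aᵢ = toℕ (A (suc i))

-- Indexed by Fin (pred m) so that it applies to any i : Fin m, without m being syntactically a successor.
skip : ∀ {m} → Fin m → Fin (pred m) → Fin m
skip {suc m} = punchIn

skip-injective : ∀ {m} (i : Fin m) → Injective _≡_ _≡_ (skip i)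
skip-injective {suc m} i = punchIn-injective i _ _

skip≢ : ∀ {m} (i : Fin m) j → skip i j ≢ i
skip≢ {suc m} = punchInᵢ≢i

skip-onto : ∀ {m} (i : Fin m) {u} → u ≢ i → ∃ λ j → skip i j ≡ u
skip-onto {suc m} i u≢i = punchOut (u≢i ∘ sym) , punchIn-punchOut (u≢i ∘ sym)

card-skip : ∀ {m} (A : Subset m) i → card A ≡ toℕ (A i) + card (A ∘ skip i)
card-skip {suc m} = card-punchIn

card-skip-at : ∀ {m} (A : Subset m) i {b} → A i ≡ b → card A ≡ toℕ b + card (A ∘ skip i)
card-skip-at A i refl = card-skip A i

remove-self : ∀ {m} (A : Subset m) i → remove A i i ≡ false
remove-self A i with i ≟ i
... | yes _ = refl
... | no i≢i = contradiction refl i≢i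

remove-≢ : ∀ {m} (A : Subset m) {i u} → u ≢ i → remove A i u ≡ A u
remove-≢ A {i} {u} u≢i with u ≟ i
... | yes u≡i = contradiction u≡i u≢i
... | no _ = refl

insert-self : ∀ {m} (A : Subset m) i → insert A i i ≡ true
insert-self A i with i ≟ i
... | yes _ = refl
... | no i≢i = contradiction refl i≢i

insert-≢ : ∀ {m} (A : Subset m) {i u} → u ≢ i → insert A i u ≡ A u
insert-≢ A {i} {u} u≢i with u ≟ i
... | yes u≡i = contradiction u≡i u≢i
... | no _ = refl

remove-true : ∀ {m} (A : Subset m) {i u} → remove A i u ≡ true → A u ≡ true × u ≢ i
remove-true A {i} {u} h with u ≟ i
... | no u≢i = h , u≢i

insert-false : ∀ {m} (A : Subset m) {i u} → insert A i u ≡ false → A u ≡ false × u ≢ i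
insert-false A {i} {u} h with u ≟ i
... | no u≢i = h , u≢i

card-remove : ∀ {m} (A : Subset m) i → card A ≡ toℕ (A i) + card (remove A i)
card-remove A i = begin
  card A                                  ≡⟨ card-skip A i ⟩
  toℕ (A i) + card (A ∘ skip i)           ≡⟨ cong (toℕ (A i) +_) (card-cong λ j → sym (remove-≢ A (skip≢ i j))) ⟩
  toℕ (A i) + card (remove A i ∘ skip i)  ≡⟨ cong (toℕ (A i) +_) i∉A∖i ⟨
  toℕ (A i) + card (remove A i)           ∎
  where
  open ≡-Reasoning
  i∉A∖i = card-skip-at (remove A i) i (remove-self A i)

card-remove-member : ∀ {m} (A : Subset m) i → A i ≡ true → card A ≡ suc (card (remove A i))
card-remove-member A i Ai≡true = trans (card-remove A i) (cong (λ b → toℕ b + card (remove A i)) Ai≡true)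

card-skip-≤ : ∀ {m} (A : Subset m) i → card (A ∘ skip i) ≤ card A
card-skip-≤ A i = ≤-trans (m≤n+m (card (A ∘ skip i)) (toℕ (A i))) (≤-reflexive (sym (card-skip A i)))

card-insert : ∀ {m} (A : Subset m) i → A i ≡ false → card (insert A i) ≡ suc (card A)
card-insert A i Ai≡false = begin
  card (insert A i)       ≡⟨ card-skip-at (insert A i) i (insert-self A i) ⟩
  suc (card (insert A i ∘ skip i)) ≡⟨ cong suc (card-cong λ j → insert-≢ A (skip≢ i j)) ⟩
  suc (card (A ∘ skip i))  ≡⟨ cong suc (card-skip-at A i Ai≡false) ⟨
  suc (card A)            ∎
  where open ≡-Reasoning

card-∅ : ∀ {m} → card {m} (λ _ → false) ≡ 0
card-∅ {zero} = refl
card-∅ {suc m} = trans (card-suc {m} (λ _ → false)) (card-∅ {m})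

insert-⊇ : ∀ {m} (A : Subset m) i → A ⊆ insert A i
insert-⊇ A i u Au with u ≟ i
... | yes _ = refl
... | no _ = Au

not-remove : ∀ {m} (A : Subset m) i u → not (remove A i u) ≡ insert (not ∘ A) i u
not-remove A i u with u ≟ i
... | yes _ = refl
... | no _ = refl

record Enumerates {A : Set} {m} (P : A → Set) (f : Fin m → A) : Set where
  field
    injective : Injective _≡_ _≡_ f
    sound     : ∀ j → P (f j)
    complete  : ∀ {x} → P x → ∃ λ j → f j ≡ x

module _ {A : Set} {m} {P Q : A → Set} {f : Fin m → A} (e : Enumerates P f) where
  open Enumerates e

  enumerates-cong : (∀ {x} → P x → Q x) → (∀ {x} → Q x → P x) → Enumerates Q f
  enumerates-cong P⇒Q Q⇒P = record
    { injective = injective ; sound = P⇒Q ∘ sound ; complete = complete ∘ Q⇒P }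

  enumerates-skip : ∀ i → (∀ {x} → P x → x ≢ f i → Q x) → (∀ {x} → Q x → P x × x ≢ f i) →
                    Enumerates Q (f ∘ skip i)
  enumerates-skip i P∖fi⇒Q Q⇒P∖fi = record
    { injective = skip-injective i ∘ injective
    ; sound = λ j → P∖fi⇒Q (sound (skip i j)) (skip≢ i j ∘ injective)
    ; complete = λ Qx → let Px , x≢fi = Q⇒P∖fi Qx ; j , fj≡x = complete Px
                            j′ , skip≡j = skip-onto i (λ j≡i → x≢fi (trans (sym fj≡x) (cong f j≡i)))
                        in j′ , trans (cong f skip≡j) fj≡x
    }

_⟨_⟩ : (G : Graph) → ∀ {m} → (Fin m → Fin (n G)) → Graph
G ⟨ f ⟩ = record
  { n = _
  ; adj = λ a b → adj G (f a) (f b)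
  ; sym = λ a b → adj-sym G (f a) (f b)
  ; irrefl = λ a → irrefl G (f a)
  }

⟨⟩-induced : ∀ G {m} (f : Fin m → Fin (n G)) → Injective _≡_ _≡_ f → InducedSubgraph (G ⟨ f ⟩) G
⟨⟩-induced G f f-inj = f , f-inj , λ _ _ → refl

nbrCount-mono : ∀ G u {A B : Subset (n G)} → A ⊆ B → nbrCount G u A ≤ nbrCount G u B
nbrCount-mono G u A⊆B = card-mono λ w → ∧-mono (adj G u w) (A⊆B w)
  where
  ∧-mono : ∀ a {b c} → (b ≡ true → c ≡ true) → a ∧ b ≡ true → a ∧ c ≡ true
  ∧-mono true b⇒c = b⇒c

nbrCount≤deg : ∀ G u A → nbrCount G u A ≤ deg G u
nbrCount≤deg G u A = card-mono λ w → ∧-true-left (adj G u w)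
  where
  ∧-true-left : ∀ a {b} → a ∧ b ≡ true → a ≡ true
  ∧-true-left true _ = refl

nbrCount-insert : ∀ G u (A : Subset (n G)) v → A v ≡ false →
                  nbrCount G u (insert A v) ≡ toℕ (adj G u v) + nbrCount G u A
nbrCount-insert G u A v Av≡false = begin
  nbrCount G u (insert A v)
    ≡⟨ card-skip-at (adjacent-in (insert A v)) v v∈insert ⟩
  toℕ (adj G u v) + card (adjacent-in (insert A v) ∘ skip v)
    ≡⟨ cong (toℕ (adj G u v) +_) (card-cong λ j → cong (adj G u (skip v j) ∧_) (insert-≢ A (skip≢ v j))) ⟩
  toℕ (adj G u v) + card (adjacent-in A ∘ skip v)
    ≡⟨ cong (toℕ (adj G u v) +_) (card-skip-at (adjacent-in A) v v∉A) ⟨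
  toℕ (adj G u v) + nbrCount G u A
    ∎
  where
  open ≡-Reasoning
  adjacent-in : Subset (n G) → Subset (n G)
  adjacent-in B w = adj G u w ∧ B w
  v∈insert : adjacent-in (insert A v) v ≡ adj G u v
  v∈insert = trans (cong (adj G u v ∧_) (insert-self A v)) (∧-identityʳ (adj G u v))
  v∉A : adjacent-in A v ≡ false
  v∉A = trans (cong (adj G u v ∧_) Av≡false) (∧-zeroʳ (adj G u v))

∨-true : ∀ a {b} → a ∨ b ≡ true → a ≡ true ⊎ b ≡ true
∨-true true _ = inj₁ refl
∨-true false b≡true = inj₂ b≡true

toℕ-∧ : ∀ a b → toℕ (a ∧ b) ≤ toℕ a
toℕ-∧ true b = toℕ-mono {b} λ _ → refl
toℕ-∧ false b = z≤n

nbrCount-skip : ∀ H i j (A : Subset (n H)) →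
  nbrCount H (skip i j) A ≤ toℕ (adj H (skip i j) i) + nbrCount (H ⟨ skip i ⟩) j (A ∘ skip i)
nbrCount-skip H i j A =
  ≤-trans (≤-reflexive (card-skip _ i)) (+-mono-≤ (toℕ-∧ (adj H (skip i j) i) (A i)) ≤-refl)

deg-skip : ∀ H i j → deg H (skip i j) ∸ toℕ (adj H i (skip i j)) ≡ deg (H ⟨ skip i ⟩) j
deg-skip H i j = begin
  deg H (skip i j) ∸ toℕ (adj H i (skip i j))  ≡⟨ cong₂ (λ d b → d ∸ toℕ b) (card-skip _ i) (adj-sym H i (skip i j)) ⟩
  b + deg (H ⟨ skip i ⟩) j ∸ b                 ≡⟨ m+n∸m≡n b _ ⟩
  deg (H ⟨ skip i ⟩) j                         ∎
  where
  open ≡-Reasoning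
  b = toℕ (adj H (skip i j) i)

decAt-≤ : ∀ G U v b (g : Fin (n G) → ℕ) u → decAt G U v b g u ≤ g u
decAt-≤ G U v b g u with adj G v u ∧ U u ∧ b
... | true = m∸n≤m (g u) 1
... | false = ≤-refl

decAt-false : ∀ G U v (g : Fin (n G) → ℕ) u → decAt G U v false g u ≡ g u
decAt-false G U v g u rewrite ∧-zeroʳ (U u) | ∧-zeroʳ (adj G v u) = refl

decAt-member : ∀ G U v (g : Fin (n G) → ℕ) u → U u ≡ true → decAt G U v true g u ≡ g u ∸ toℕ (adj G v u)
decAt-member G U v g u Uu rewrite Uu with adj G v u
... | true = refl
... | false = refl

module _ (G : Graph) where

  activated-suc : ∀ κ S ℓ {u} → activated G κ S ℓ u ≡ true → activated G κ S (suc ℓ) u ≡ true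
  activated-suc κ S ℓ h rewrite h = refl

  activated-by-threshold : ∀ κ S ℓ {u} → κ u ≤ nbrCount G u (activated G κ S ℓ) →
                           activated G κ S (suc ℓ) u ≡ true
  activated-by-threshold κ S ℓ {u} h
    rewrite Equivalence.to T-≡ (≤⇒≤ᵇ h) = ∨-zeroʳ (activated G κ S ℓ u)

  activated-suc-inv : ∀ κ S ℓ {u} → activated G κ S (suc ℓ) u ≡ true →
                      activated G κ S ℓ u ≡ true ⊎ κ u ≤ nbrCount G u (activated G κ S ℓ)
  activated-suc-inv κ S ℓ {u} h with ∨-true (activated G κ S ℓ u) h
  ... | inj₁ earlier = inj₁ earlier
  ... | inj₂ now = inj₂ (≤ᵇ⇒≤ (κ u) _ (Equivalence.from T-≡ now))

  seed⊆activated : ∀ κ S ℓ → S ⊆ activated G κ S ℓ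
  seed⊆activated κ S zero u Su = Su
  seed⊆activated κ S (suc ℓ) u Su = activated-suc κ S ℓ (seed⊆activated κ S ℓ u Su)

  activated-mono : ∀ {κ κ′ S S′} → (∀ u → κ′ u ≤ κ u) → S ⊆ S′ →
                   ∀ ℓ → activated G κ S ℓ ⊆ activated G κ′ S′ ℓ
  activated-mono κ′≤κ S⊆S′ zero = S⊆S′
  activated-mono {κ} {κ′} {S} {S′} κ′≤κ S⊆S′ (suc ℓ) u h with activated-suc-inv κ S ℓ h
  ... | inj₁ earlier = activated-suc κ′ S′ ℓ (activated-mono κ′≤κ S⊆S′ ℓ u earlier)
  ... | inj₂ now = activated-by-threshold κ′ S′ ℓ
        (≤-trans (κ′≤κ u) (≤-trans now (nbrCount-mono G u (activated-mono κ′≤κ S⊆S′ ℓ))))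

  target-mono : ∀ {κ κ′ S S′} → (∀ u → κ′ u ≤ κ u) → S ⊆ S′ → IsTargetSet G κ S → IsTargetSet G κ′ S′
  target-mono κ′≤κ S⊆S′ (ℓ , all) = ℓ , λ u → activated-mono κ′≤κ S⊆S′ ℓ u (all u)

  target-forces : ∀ {κ S} i → deg G i < κ i → IsTargetSet G κ S → S i ≡ true
  target-forces {κ} {S} i deg<κ (ℓ , all) = go ℓ (all i)
    where
    go : ∀ ℓ → activated G κ S ℓ i ≡ true → S i ≡ true
    go zero Si = Si
    go (suc ℓ) h with activated-suc-inv κ S ℓ h
    ... | inj₁ earlier = go ℓ earlier
    ... | inj₂ now = contradiction (≤-trans now (nbrCount≤deg G i _)) (<⇒≱ deg<κ)

module _ (H : Graph) (i : Fin (n H)) where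

  private
    H′ = H ⟨ skip i ⟩

  -- Stated with ∸ because Case 1 lowers k by max(k − 1, 0), also at neighbours whose k is already 0.
  activated-skip : ∀ {κ κ′ S} → (∀ j → κ′ j ≤ κ (skip i j) ∸ toℕ (adj H (skip i j) i)) →
                   ∀ ℓ j → activated H κ S ℓ (skip i j) ≡ true →
                   activated H′ κ′ (S ∘ skip i) ℓ j ≡ true
  activated-skip κ′≤κ∸1 zero j h = h
  activated-skip {κ} {κ′} {S} κ′≤κ∸1 (suc ℓ) j h with activated-suc-inv H κ S ℓ h
  ... | inj₁ earlier = activated-suc H′ κ′ (S ∘ skip i) ℓ (activated-skip κ′≤κ∸1 ℓ j earlier)
  ... | inj₂ now = activated-by-threshold H′ κ′ (S ∘ skip i) ℓ (begin
    κ′ j                                 ≤⟨ κ′≤κ∸1 j ⟩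
    κ (skip i j) ∸ b                     ≤⟨ ∸-monoˡ-≤ b (≤-trans now (nbrCount-skip H i j _)) ⟩
    b + nbrCount H′ j (A ∘ skip i) ∸ b   ≡⟨ m+n∸m≡n b _ ⟩
    nbrCount H′ j (A ∘ skip i)           ≤⟨ nbrCount-mono H′ j (activated-skip κ′≤κ∸1 ℓ) ⟩
    nbrCount H′ j (activated H′ κ′ (S ∘ skip i) ℓ) ∎)
    where
    open ≤-Reasoning
    b = toℕ (adj H (skip i j) i)
    A = activated H κ S ℓ

  target-skip : ∀ {κ κ′ S} → (∀ j → κ′ j ≤ κ (skip i j) ∸ toℕ (adj H (skip i j) i)) →
                IsTargetSet H κ S → IsTargetSet H′ κ′ (S ∘ skip i)
  target-skip κ′≤κ∸1 (ℓ , all) = ℓ , λ j → activated-skip κ′≤κ∸1 ℓ j (all (skip i j))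

maximum-exists : ∀ {m} (P : Subset m) (_≼_ : Fin m → Fin m → Set) →
  (∀ x y → x ≼ y ⊎ y ≼ x) → (∀ {x y z} → P y ≡ true → x ≼ y → y ≼ z → x ≼ z) →
  (∀ v → P v ≡ false) ⊎ ∃ λ v → P v ≡ true × (∀ u → P u ≡ true → u ≼ v)
maximum-exists {zero} P _≼_ total trans≼ = inj₁ λ ()
maximum-exists {suc m} P _≼_ total trans≼
  with maximum-exists (P ∘ suc) (λ x y → suc x ≼ suc y) (λ x y → total (suc x) (suc y)) trans≼
     | P zero in P0
... | inj₁ none | false = inj₁ λ { zero → P0 ; (suc x) → none x }
... | inj₁ none | true = inj₂ (zero , P0 , λ
  { zero _ → reduce (total zero zero)
  ; (suc x) Px → contradiction (trans (sym Px) (none x)) λ () })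
... | inj₂ (v , Pv , max) | false = inj₂ (suc v , Pv , λ
  { zero P0′ → contradiction (trans (sym P0′) P0) λ ()
  ; (suc x) Px → max x Px })
... | inj₂ (v , Pv , max) | true with total zero (suc v)
...   | inj₁ 0≼v = inj₂ (suc v , Pv , λ { zero _ → 0≼v ; (suc x) Px → max x Px })
...   | inj₂ v≼0 = inj₂ (zero , P0 , λ
  { zero _ → reduce (total zero zero)
  ; (suc x) Px → trans≼ Pv (max x Px) v≼0 })

cross-mult-trans : ∀ a b c x y z .{{_ : NonZero y}} → a * y ≤ b * x → b * z ≤ c * y → a * z ≤ c * x
cross-mult-trans a b c x y z ay≤bx bz≤cy = *-cancelʳ-≤ (a * z) (c * x) y (begin
  a * z * y ≡⟨ xy∙z≈xz∙y *-commutativeSemigroup a z y ⟩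
  a * y * z ≤⟨ *-monoˡ-≤ z ay≤bx ⟩
  b * x * z ≡⟨ xy∙z≈xz∙y *-commutativeSemigroup b x z ⟩
  b * z * x ≤⟨ *-monoˡ-≤ x bz≤cy ⟩
  c * y * x ≡⟨ xy∙z≈xz∙y *-commutativeSemigroup c y x ⟩
  c * x * y ∎)
  where open ≤-Reasoning

RatioLE : ∀ {m} → (k δ : Fin m → ℕ) → Fin m → Fin m → Set
RatioLE k δ u v = k u * (δ v * suc (δ v)) ≤ k v * (δ u * suc (δ u))

RatioLE-cong : ∀ {m m′} {k δ : Fin m → ℕ} {k′ δ′ : Fin m′ → ℕ} {u v u′ v′} →
               k u ≡ k′ u′ → k v ≡ k′ v′ → δ u ≡ δ′ u′ → δ v ≡ δ′ v′ →
               RatioLE k′ δ′ u′ v′ → RatioLE k δ u v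
RatioLE-cong ku kv δu δv h rewrite ku | kv | δu | δv = h

RatioLE-trans : ∀ {m} (k δ : Fin m → ℕ) {u v w} → k v ≢ 0 → k v ≤ δ v →
                RatioLE k δ u v → RatioLE k δ v w → RatioLE k δ u w
RatioLE-trans k δ {u} {v} {w} kv≢0 kv≤δv =
  cross-mult-trans (k u) (k v) (k w) _ _ _ {{denominator≢0 kv≢0 kv≤δv}}
  where
  denominator≢0 : ∀ {a d} → a ≢ 0 → a ≤ d → NonZero (d * suc d)
  denominator≢0 {d = zero} a≢0 a≤0 = contradiction (n≤0⇒n≡0 a≤0) a≢0
  denominator≢0 {d = suc d} _ _ = _

module _ (H : Graph) where

  tss-progress-by-case3 : ∀ {S U k δ} → TNoCase1 (tstate S U k δ) → (∀ w → U w ≡ true → k w ≤ δ w) →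
                       (∀ v → U v ≡ false) ⊎ ∃ (TStep H (tstate S U k δ))
  tss-progress-by-case3 {U = U} {k} {δ} k≢0 k≤δ
    with maximum-exists U (RatioLE k δ) (λ _ _ → ≤-total _ _)
                        (λ {_} {v} Uv → RatioLE-trans k δ (k≢0 v Uv) (k≤δ v Uv))
  ... | inj₁ U-empty = inj₁ U-empty
  ... | inj₂ (v , Uv , max) = inj₂ (_ , case3 v k≢0 k≤δ Uv max)

  tss-progress-by-case2or3 : ∀ {S U k δ} → TNoCase1 (tstate S U k δ) →
                             (∀ v → U v ≡ false) ⊎ ∃ (TStep H (tstate S U k δ))
  tss-progress-by-case2or3 {U = U} {k} {δ} k≢0 with any? (λ v → (U v Bool.≟ true) ×-dec (δ v <? k v))
  ... | yes (v , Uv , δ<k) = inj₂ (_ , case2 v k≢0 Uv δ<k)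
  ... | no ¬case2 = tss-progress-by-case3 k≢0 λ w Uw → ≮⇒≥ λ δ<k → ¬case2 (w , Uw , δ<k)

  tss-progress : (s : TState (n H)) → (∀ v → tU s v ≡ false) ⊎ ∃ (TStep H s)
  tss-progress (tstate S U k δ) with any? (λ v → (U v Bool.≟ true) ×-dec (k v ℕ.≟ 0))
  ... | yes (v , Uv , kv≡0) = inj₂ (_ , case1 v Uv kv≡0)
  ... | no ¬case1 = tss-progress-by-case2or3 λ w Uw kw≡0 → ¬case1 (w , Uw , kw≡0)

  TStep-removes : ∀ {s s′} → TStep H s s′ → card (tU s) ≡ suc (card (tU s′))
  TStep-removes (case1 {U = U} v Uv _) = card-remove-member U v Uv
  TStep-removes (case2 {U = U} v _ Uv _) = card-remove-member U v Uv
  TStep-removes (case3 {U = U} v _ _ Uv _) = card-remove-member U v Uv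

  tss-terminates : (s : TState (n H)) → ∃ λ fin → Star (TStep H) s fin × (∀ v → tU fin v ≡ false)
  tss-terminates s = go (card (tU s)) s refl
    where
    go : ∀ c s → card (tU s) ≡ c → ∃ λ fin → Star (TStep H) s fin × (∀ v → tU fin v ≡ false)
    go c s |U|≡c with tss-progress s
    ... | inj₁ U-empty = s , ε , U-empty
    go zero s |U|≡0 | inj₂ (s′ , step) = contradiction (trans (sym (TStep-removes step)) |U|≡0) λ ()
    go (suc c) s |U|≡1+c | inj₂ (s′ , step)
      with go c s′ (suc-injective (trans (sym (TStep-removes step)) |U|≡1+c))
    ... | fin , run , done = fin , step ◅ run , done

module _ (H : Graph) (i : Fin (n H)) where

  private
    H′ = H ⟨ skip i ⟩

  record Lifts (s : TState (n H)) (s′ : TState (n H′)) : Set where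
    field
      S-skip : ∀ j → tS s (skip i j) ≡ tS s′ j
      S-at   : tS s i ≡ false
      U-skip : ∀ j → tU s (skip i j) ≡ tU s′ j
      U-at   : tU s i ≡ false
      k-skip : ∀ j → tk s (skip i j) ≡ tk s′ j
      δ-skip : ∀ j → tδ s (skip i j) ≡ tδ s′ j

  private
    lift-remove : ∀ (A : Subset (n H)) (A′ : Subset (n H′)) v′ j →
                  A (skip i j) ≡ A′ j → remove A (skip i v′) (skip i j) ≡ remove A′ v′ j
    lift-remove A A′ v′ j A≡A′ with j ≟ v′
    ... | yes refl = remove-self A (skip i j)
    ... | no j≢v′ = trans (remove-≢ A (j≢v′ ∘ skip-injective i)) A≡A′

    lift-insert : ∀ (A : Subset (n H)) (A′ : Subset (n H′)) v′ j →
                  A (skip i j) ≡ A′ j → insert A (skip i v′) (skip i j) ≡ insert A′ v′ j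
    lift-insert A A′ v′ j A≡A′ with j ≟ v′
    ... | yes refl = insert-self A (skip i j)
    ... | no j≢v′ = trans (insert-≢ A (j≢v′ ∘ skip-injective i)) A≡A′

    lift-decAt : ∀ (U : Subset (n H)) (U′ : Subset (n H′)) (g : Fin (n H) → ℕ) (g′ : Fin (n H′) → ℕ) v′ j →
                 U (skip i j) ≡ U′ j → g (skip i j) ≡ g′ j →
                 decAt H U (skip i v′) true g (skip i j) ≡ decAt H′ U′ v′ true g′ j
    lift-decAt U U′ g g′ v′ j U≡U′ g≡g′ rewrite U≡U′ | g≡g′ = refl

    remove-at : ∀ (A : Subset (n H)) v′ → remove A (skip i v′) i ≡ A i
    remove-at A v′ = remove-≢ A (skip≢ i v′ ∘ sym)

    insert-at : ∀ (A : Subset (n H)) v′ → insert A (skip i v′) i ≡ A i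
    insert-at A v′ = insert-≢ A (skip≢ i v′ ∘ sym)

    every-member : ∀ (U : Subset (n H)) → U i ≡ false → (P : Fin (n H) → Set) →
                   (∀ j → U (skip i j) ≡ true → P (skip i j)) → ∀ w → U w ≡ true → P w
    every-member U Ui≡false P P-skip w Uw with w ≟ i
    ... | yes refl = contradiction (trans (sym Ui≡false) Uw) λ ()
    ... | no w≢i with skip-onto i w≢i
    ... | j , refl = P-skip j Uw

  lift-step : ∀ {s s′ s″} → Lifts s s′ → TStep H′ s′ s″ → ∃ λ t → TStep H s t × Lifts t s″
  lift-step {tstate S U k δ} l (case1 {U = U′} {k′} {δ′} v′ Uv′ kv′≡0) =
    _ , case1 (skip i v′) (trans (U-skip v′) Uv′) (trans (k-skip v′) kv′≡0) , record
      { S-skip = S-skip ; S-at = S-at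
      ; U-skip = λ j → lift-remove U U′ v′ j (U-skip j) ; U-at = trans (remove-at U v′) U-at
      ; k-skip = λ j → lift-decAt U U′ k k′ v′ j (U-skip j) (k-skip j)
      ; δ-skip = λ j → lift-decAt U U′ δ δ′ v′ j (U-skip j) (δ-skip j) }
    where open Lifts l
  lift-step {tstate S U k δ} l (case2 {S′} {U′} {k′} {δ′} v′ k′≢0 Uv′ δ′<k′) =
    _ , case2 (skip i v′) k≢0 (trans (U-skip v′) Uv′) δ<k , record
      { S-skip = λ j → lift-insert S S′ v′ j (S-skip j) ; S-at = trans (insert-at S v′) S-at
      ; U-skip = λ j → lift-remove U U′ v′ j (U-skip j) ; U-at = trans (remove-at U v′) U-at
      ; k-skip = λ j → lift-decAt U U′ k k′ v′ j (U-skip j) (k-skip j)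
      ; δ-skip = λ j → lift-decAt U U′ δ δ′ v′ j (U-skip j) (δ-skip j) }
    where
    open Lifts l
    k≢0 : TNoCase1 (tstate S U k δ)
    k≢0 = every-member U U-at _ λ j Uj → subst (_≢ 0) (sym (k-skip j)) (k′≢0 j (trans (sym (U-skip j)) Uj))
    δ<k : δ (skip i v′) < k (skip i v′)
    δ<k = subst₂ _<_ (sym (δ-skip v′)) (sym (k-skip v′)) δ′<k′
  lift-step {tstate S U k δ} l (case3 {U = U′} {k′} {δ′} v′ k′≢0 k′≤δ′ Uv′ max′) =
    _ , case3 (skip i v′) k≢0 k≤δ (trans (U-skip v′) Uv′) max , record
      { S-skip = S-skip ; S-at = S-at
      ; U-skip = λ j → lift-remove U U′ v′ j (U-skip j) ; U-at = trans (remove-at U v′) U-at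
      ; k-skip = k-skip
      ; δ-skip = λ j → lift-decAt U U′ δ δ′ v′ j (U-skip j) (δ-skip j) }
    where
    open Lifts l
    U-skip⁻ : ∀ j → U (skip i j) ≡ true → U′ j ≡ true
    U-skip⁻ j Uj = trans (sym (U-skip j)) Uj
    k≢0 : TNoCase1 (tstate S U k δ)
    k≢0 = every-member U U-at _ λ j Uj → subst (_≢ 0) (sym (k-skip j)) (k′≢0 j (U-skip⁻ j Uj))
    k≤δ : ∀ w → U w ≡ true → k w ≤ δ w
    k≤δ = every-member U U-at _ λ j Uj →
      subst₂ _≤_ (sym (k-skip j)) (sym (δ-skip j)) (k′≤δ′ j (U-skip⁻ j Uj))
    max : ∀ w → U w ≡ true → RatioLE k δ w (skip i v′)
    max = every-member U U-at _ λ j Uj →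
      RatioLE-cong {k = k} {δ} {k′} {δ′} (k-skip j) (k-skip v′) (δ-skip j) (δ-skip v′)
                   (max′ j (U-skip⁻ j Uj))

  lift-run : ∀ {s s′ fin′} → Lifts s s′ → Star (TStep H′) s′ fin′ →
             ∃ λ fin → Star (TStep H) s fin × Lifts fin fin′
  lift-run l ε = _ , ε , l
  lift-run l (step ◅ steps) with lift-step l step
  ... | t , stepH , l′ with lift-run l′ steps
  ... | fin , stepsH , l″ = fin , stepH ◅ stepsH , l″

  lifts-init : ∀ κ →
    Lifts (tstate (λ _ → false) (remove (λ _ → true) i) κ (decAt H (λ _ → true) i true (deg H))) (tInit H′ (κ ∘ skip i))
  lifts-init κ = record
    { S-skip = λ _ → refl ; S-at = refl
    ; U-skip = λ j → remove-≢ _ (skip≢ i j) ; U-at = remove-self _ i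
    ; k-skip = λ _ → refl
    ; δ-skip = λ j → trans (decAt-member H _ i (deg H) (skip i j) refl) (deg-skip H i j) }

  tss-deletes-maximiser : ∀ {κ} → TSSOptimalOn H κ → TSSOptimalOn H′ (κ ∘ skip i) →
    (∀ w → κ w ≢ 0) → (∀ w → κ w ≤ deg H w) → (∀ w → RatioLE κ (deg H) w i) →
    ∃ λ T′ → IsTargetSet H′ (κ ∘ skip i) T′ × (∀ T → IsTargetSet H κ T → card T′ ≤ card T)
  tss-deletes-maximiser {κ} optimal optimal′ κ≢0 κ≤deg max
    with tss-terminates H′ (tInit H′ (κ ∘ skip i))
  ... | fin′ , run′ , done′ with lift-run (lifts-init κ) run′
  ... | fin , run , l = tS fin′ , proj₁ (optimal′ fin′ run′ done′) , λ T T-target → begin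
    card (tS fin′)          ≡⟨ card-cong S-skip ⟨
    card (tS fin ∘ skip i)  ≡⟨ card-skip-at (tS fin) i S-at ⟨
    card (tS fin)           ≤⟨ proj₂ (optimal fin (first ◅ run) done) T T-target ⟩
    card T                  ∎
    where
    open ≤-Reasoning
    open Lifts l
    first : TStep H (tInit H κ) _
    first = case3 i (λ w _ → κ≢0 w) (λ w _ → κ≤deg w) refl (λ w _ → max w)
    done : ∀ v → tU fin v ≡ false
    done v with v ≟ i
    ... | yes refl = U-at
    ... | no v≢i with skip-onto i v≢i
    ... | j , refl = trans (U-skip j) (done′ j)

module MTS (G : Graph) (t : Fin (n G) → ℕ)
           (tss-optimal : ∀ {m} (f : Fin m → Fin (n G)) → Injective _≡_ _≡_ f →
                          ∀ κ → TSSOptimalOn (G ⟨ f ⟩) κ)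
  where

  record Settled (S U : Subset (n G)) (k : Fin (n G) → ℕ) : Set where
    field
      seeds-settled : ∀ u → S u ≡ true → U u ≡ true → ⊥
      settled-activated : ∃ λ ℓ → ∀ u → U u ≡ false → activated G t S ℓ u ≡ true
      budget : ∀ u → U u ≡ true → t u ≤ k u + nbrCount G u (not ∘ U)

  Live : Subset (n G) → Subset (n G) → Fin (n G) → Set
  Live U L u = U u ≡ true × L u ≡ false

  record Residual (st : MState (n G)) : Set where
    field
      {size} : ℕ
      f : Fin size → Fin (n G)
      enumerates : Enumerates (Live (U st) (L st)) f
      δ≡deg : ∀ j → δ st (f j) ≡ deg (G ⟨ f ⟩) j
      bound : ∀ T → IsTargetSet G t T →
              ∃ λ T′ → IsTargetSet (G ⟨ f ⟩) (k st ∘ f) T′ × card (S st) + card T′ ≤ card T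

  Invariant : MState (n G) → Set
  Invariant st = Settled (S st) (U st) (k st) × Residual st

  private
    not≡true : ∀ b → not b ≡ true → b ≡ false
    not≡true false _ = refl

  budget-remove : ∀ {U : Subset (n G)} {k} v → U v ≡ true →
                  (∀ u → U u ≡ true → t u ≤ k u + nbrCount G u (not ∘ U)) →
                  ∀ u → remove U v u ≡ true → t u ≤ decAt G U v true k u + nbrCount G u (not ∘ remove U v)
  budget-remove {U} {k} v Uv budget u u∈U′ = begin
    t u
      ≤⟨ budget u Uu ⟩
    k u + N
      ≤⟨ +-monoˡ-≤ N (m≤n+m∸n (k u) b) ⟩
    b + (k u ∸ b) + N
      ≡⟨ xy∙z≈y∙xz +-commutativeSemigroup b (k u ∸ b) N ⟩
    k u ∸ b + (b + N)
      ≡⟨ cong₂ _+_ (decAt-member G U v k u Uu) (cong (λ a → toℕ a + N) (adj-sym G u v)) ⟨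
    decAt G U v true k u + (toℕ (adj G u v) + N)
      ≡⟨ cong (decAt G U v true k u +_) removed-neighbour ⟨
    decAt G U v true k u + nbrCount G u (not ∘ remove U v)
      ∎
    where
    open ≤-Reasoning
    Uu = proj₁ (remove-true U u∈U′)
    b = toℕ (adj G v u)
    N = nbrCount G u (not ∘ U)
    removed-neighbour : nbrCount G u (not ∘ remove U v) ≡ toℕ (adj G u v) + N
    removed-neighbour = trans (card-cong λ w → cong (adj G u w ∧_) (not-remove U v w))
                              (nbrCount-insert G u (not ∘ U) v (cong not Uv))

  settled-case1 : ∀ {S U k} v → U v ≡ true → k v ≡ 0 → Settled S U k →
                  Settled S (remove U v) (decAt G U v true k)
  settled-case1 {S} {U} {k} v Uv kv≡0 s = record
    { seeds-settled = λ u Su u∈U′ → seeds-settled u Su (proj₁ (remove-true U u∈U′))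
    ; settled-activated = suc ℓ , activated′
    ; budget = budget-remove v Uv budget
    }
    where
    open Settled s
    ℓ = proj₁ settled-activated
    activated′ : ∀ u → remove U v u ≡ false → activated G t S (suc ℓ) u ≡ true
    activated′ u u∉U′ with u ≟ v
    ... | no _ = activated-suc G t S ℓ (proj₂ settled-activated u u∉U′)
    ... | yes refl = activated-by-threshold G t S ℓ (begin
      t u                               ≤⟨ budget u Uv ⟩
      k u + nbrCount G u (not ∘ U)      ≡⟨ cong (_+ _) kv≡0 ⟩
      nbrCount G u (not ∘ U)            ≤⟨ nbrCount-mono G u removed⊆activated ⟩
      nbrCount G u (activated G t S ℓ)  ∎)
      where
      open ≤-Reasoning
      removed⊆activated : (not ∘ U) ⊆ activated G t S ℓ
      removed⊆activated w w∉U = proj₂ settled-activated w (not≡true (U w) w∉U)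

  settled-case2 : ∀ {S U k} v → U v ≡ true → Settled S U k →
                  Settled (insert S v) (remove U v) (decAt G U v true k)
  settled-case2 {S} {U} {k} v Uv s = record
    { seeds-settled = seeds-settled′
    ; settled-activated = ℓ , activated′
    ; budget = budget-remove v Uv budget
    }
    where
    open Settled s
    ℓ = proj₁ settled-activated
    seeds-settled′ : ∀ u → insert S v u ≡ true → remove U v u ≡ true → ⊥
    seeds-settled′ u u∈S′ u∈U′ with remove-true U u∈U′
    ... | Uu , u≢v = seeds-settled u (trans (sym (insert-≢ S u≢v)) u∈S′) Uu
    activated′ : ∀ u → remove U v u ≡ false → activated G t (insert S v) ℓ u ≡ true
    activated′ u u∉U′ with u ≟ v
    ... | yes refl = seed⊆activated G t (insert S v) ℓ u (insert-self S u)
    ... | no _ = activated-mono G (λ _ → ≤-refl) (insert-⊇ S v) ℓ u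
                     (proj₂ settled-activated u u∉U′)

  module _ (U L : Subset (n G)) (v : Fin (n G)) where

    live-remove : ∀ {x} → Live U L x → x ≢ v → Live (remove U v) L x
    live-remove (Ux , Lx) x≢v = trans (remove-≢ U x≢v) Ux , Lx

    live-remove⁻ : ∀ {x} → Live (remove U v) L x → Live U L x × x ≢ v
    live-remove⁻ (x∈U′ , Lx) = let Ux , x≢v = remove-true U x∈U′ in (Ux , Lx) , x≢v

    live-insert : ∀ {x} → Live U L x → x ≢ v → Live U (insert L v) x
    live-insert (Ux , Lx) x≢v = Ux , trans (insert-≢ L x≢v) Lx

    live-insert⁻ : ∀ {x} → Live U (insert L v) x → Live U L x × x ≢ v
    live-insert⁻ (Ux , x∉L′) = let Lx , x≢v = insert-false L x∉L′ in (Ux , Lx) , x≢v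

  module _ {st : MState (n G)} (r : Residual st) where
    open Residual r
    open Enumerates enumerates

    residual-delete : ∀ {st′} i →
      (∀ {x} → Live (U st) (L st) x → x ≢ f i → Live (U st′) (L st′) x) →
      (∀ {x} → Live (U st′) (L st′) x → Live (U st) (L st) x × x ≢ f i) →
      (∀ j → δ st′ (f (skip i j)) ≡ decAt G (U st) (f i) true (δ st) (f (skip i j))) →
      (∀ T′ → IsTargetSet (G ⟨ f ⟩) (k st ∘ f) T′ →
         ∃ λ T″ → IsTargetSet (G ⟨ f ∘ skip i ⟩) (k st′ ∘ f ∘ skip i) T″ ×
                  card (S st′) + card T″ ≤ card (S st) + card T′) →
      Residual st′
    residual-delete {st′} i live live⁻ δ′≡ shrink = record
      { f = f ∘ skip i
      ; enumerates = enumerates-skip enumerates i live live⁻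
      ; δ≡deg = δ≡deg′
      ; bound = λ T T-target → let T′ , T′-target , S+T′≤T = bound T T-target
                                   T″ , T″-target , S′+T″≤S+T′ = shrink T′ T′-target
                               in T″ , T″-target , ≤-trans S′+T″≤S+T′ S+T′≤T
      }
      where
      δ≡deg′ : ∀ j → δ st′ (f (skip i j)) ≡ deg (G ⟨ f ∘ skip i ⟩) j
      δ≡deg′ j = begin
        δ st′ (f (skip i j))                             ≡⟨ δ′≡ j ⟩
        decAt G (U st) (f i) true (δ st) (f (skip i j))  ≡⟨ decAt-member G (U st) _ (δ st) _ (proj₁ (sound (skip i j))) ⟩
        δ st (f (skip i j)) ∸ b                          ≡⟨ cong (_∸ b) (δ≡deg (skip i j)) ⟩
        deg (G ⟨ f ⟩) (skip i j) ∸ b                     ≡⟨ deg-skip (G ⟨ f ⟩) i j ⟩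
        deg (G ⟨ f ∘ skip i ⟩) j                         ∎
        where
        open ≡-Reasoning
        b = toℕ (adj G (f i) (f (skip i j)))

    decAt-threshold : ∀ i j → decAt G (U st) (f i) true (k st) (f (skip i j)) ≤
                              k st (f (skip i j)) ∸ toℕ (adj G (f (skip i j)) (f i))
    decAt-threshold i j = ≤-reflexive (begin
      decAt G (U st) (f i) true (k st) (f (skip i j))           ≡⟨ decAt-member G (U st) _ (k st) _ (proj₁ (sound (skip i j))) ⟩
      k st (f (skip i j)) ∸ toℕ (adj G (f i) (f (skip i j)))    ≡⟨ cong (λ a → _ ∸ toℕ a) (adj-sym G (f i) (f (skip i j))) ⟩
      k st (f (skip i j)) ∸ toℕ (adj G (f (skip i j)) (f i))    ∎)
      where open ≡-Reasoning

  residual-case1 : ∀ {S L U k δ} v → U v ≡ true → Residual (mstate S L U k δ) →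
    Residual (mstate S L (remove U v) (decAt G U v true k) (decAt G U v (not (L v)) δ))
  residual-case1 {S} {L} {U} {k} {δ} v Uv r with L v in Lv
  ... | true = record
    { f = f
    ; enumerates = enumerates-cong enumerates (λ live → live-remove U L v live (v-not-live live))
                                              (proj₁ ∘ live-remove⁻ U L v)
    ; δ≡deg = λ j → trans (decAt-false G U v δ (f j)) (δ≡deg j)
    ; bound = λ T T-target → let T′ , T′-target , S+T′≤T = bound T T-target
                             in T′ , target-mono (G ⟨ f ⟩) (λ j → decAt-≤ G U v true k (f j)) (λ _ → id) T′-target
                                   , S+T′≤T
    }
    where
    open Residual r
    open Enumerates enumerates
    v-not-live : ∀ {x} → Live U L x → x ≢ v
    v-not-live (_ , Lx) refl = contradiction (trans (sym Lv) Lx) λ ()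
  ... | false with Enumerates.complete (Residual.enumerates r) (Uv , Lv)
  ... | i , refl = residual-delete r i (live-remove U L (f i)) (live-remove⁻ U L (f i)) (λ _ → refl) λ T′ T′-target →
    T′ ∘ skip i , target-skip (G ⟨ f ⟩) i (decAt-threshold r i) T′-target
                , +-monoʳ-≤ (card S) (card-skip-≤ T′ i)
    where open Residual r

  residual-case2 : ∀ {S L U k δ} v → U v ≡ true → L v ≡ false → δ v < k v → Settled S U k →
    Residual (mstate S L U k δ) →
    Residual (mstate (insert S v) L (remove U v) (decAt G U v true k) (decAt G U v true δ))
  residual-case2 {S} {L} {U} {k} {δ} v Uv Lv δ<k s r with Enumerates.complete (Residual.enumerates r) (Uv , Lv)
  ... | i , refl = residual-delete r i (live-remove U L (f i)) (live-remove⁻ U L (f i)) (λ _ → refl) shrink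
    where
    open Residual r
    fi∉S : S (f i) ≡ false
    fi∉S with S (f i) in Sfi
    ... | true = ⊥-elim (Settled.seeds-settled s (f i) Sfi Uv)
    ... | false = refl
    shrink : ∀ T′ → IsTargetSet (G ⟨ f ⟩) (k ∘ f) T′ → ∃ λ T″ →
             IsTargetSet (G ⟨ f ∘ skip i ⟩) (decAt G U (f i) true k ∘ f ∘ skip i) T″ ×
             card (insert S (f i)) + card T″ ≤ card S + card T′
    shrink T′ T′-target = T′ ∘ skip i , target-skip (G ⟨ f ⟩) i (decAt-threshold r i) T′-target , ≤-reflexive (begin
      card (insert S (f i)) + card (T′ ∘ skip i)  ≡⟨ cong (_+ card (T′ ∘ skip i)) (card-insert S (f i) fi∉S) ⟩
      suc (card S) + card (T′ ∘ skip i)           ≡⟨ +-suc (card S) _ ⟨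
      card S + suc (card (T′ ∘ skip i))           ≡⟨ cong (card S +_) (card-skip-at T′ i fi∈T′) ⟨
      card S + card T′                            ∎)
      where
      open ≡-Reasoning
      fi∈T′ : T′ i ≡ true
      fi∈T′ = target-forces (G ⟨ f ⟩) i (subst (_< k (f i)) (δ≡deg i) δ<k) T′-target

  residual-case3 : ∀ {S L U k δ} v → NoCase1 (mstate S L U k δ) →
    (∀ w → U w ≡ true → L w ≡ false → k w ≤ δ w) → U v ≡ true → L v ≡ false →
    (∀ w → U w ≡ true → L w ≡ false → RatioLE k δ w v) →
    Residual (mstate S L U k δ) → Residual (mstate S (insert L v) U k (decAt G U v true δ))
  residual-case3 {S} {L} {U} {k} {δ} v k≢0 k≤δ Uv Lv max r
    with Enumerates.complete (Residual.enumerates r) (Uv , Lv)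
  ... | i , refl = residual-delete r i (live-insert U L (f i)) (live-insert⁻ U L (f i)) (λ _ → refl) shrink
    where
    open Residual r
    open Enumerates enumerates
    shrink : ∀ T′ → IsTargetSet (G ⟨ f ⟩) (k ∘ f) T′ → ∃ λ T″ →
             IsTargetSet (G ⟨ f ∘ skip i ⟩) (k ∘ f ∘ skip i) T″ × card S + card T″ ≤ card S + card T′
    shrink T′ T′-target = let T″ , T″-target , T″-minimal = H∖fi-solution
                          in T″ , T″-target , +-monoʳ-≤ (card S) (T″-minimal T′ T′-target)
      where
      H∖fi-solution = tss-deletes-maximiser (G ⟨ f ⟩) i
        (tss-optimal f injective (k ∘ f))
        (tss-optimal (f ∘ skip i) (skip-injective i ∘ injective) (k ∘ f ∘ skip i))
        (λ w → k≢0 (f w) (proj₁ (sound w)))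
        (λ w → subst (k (f w) ≤_) (δ≡deg w) (k≤δ (f w) (proj₁ (sound w)) (proj₂ (sound w))))
        (λ w → RatioLE-cong {k = k ∘ f} {deg (G ⟨ f ⟩)} {k} {δ} refl refl (sym (δ≡deg w)) (sym (δ≡deg i))
                 (max (f w) (proj₁ (sound w)) (proj₂ (sound w))))

  invariant-init : Invariant (mInit G t)
  invariant-init = settled , residual
    where
    settled : Settled (λ _ → false) (λ _ → true) t
    settled = record
      { seeds-settled = λ _ ()
      ; settled-activated = 0 , λ _ ()
      ; budget = λ u _ → m≤m+n (t u) _
      }
    residual : Residual (mInit G t)
    residual = record
      { f = id
      ; enumerates = record { injective = id ; sound = λ _ → refl , refl ; complete = λ {x} _ → x , refl }
      ; δ≡deg = λ _ → refl
      ; bound = λ T T-target → T , T-target , ≤-reflexive (cong (_+ card T) (card-∅ {n G}))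
      }

  invariant-step : ∀ {st st′} → MStep G st st′ → Invariant st → Invariant st′
  invariant-step (case1 v Uv kv≡0) (s , r) = settled-case1 v Uv kv≡0 s , residual-case1 v Uv r
  invariant-step (case2 v _ Uv Lv δ<k) (s , r) = settled-case2 v Uv s , residual-case2 v Uv Lv δ<k s r
  invariant-step (case3 v k≢0 k≤δ Uv Lv max) (s , r) = s , residual-case3 v k≢0 k≤δ Uv Lv max r

  invariant-run : ∀ {st st′} → Star (MStep G) st st′ → Invariant st → Invariant st′
  invariant-run ε inv = inv
  invariant-run (step ◅ steps) inv = invariant-run steps (invariant-step step inv)

  mts-optimal : MTSOptimalOn G t
  mts-optimal fin run done = (ℓ , λ u → settled u (done u)) , λ T T-target →
    let _ , _ , S+T′≤T = Residual.bound r T T-target in ≤-trans (m≤m+n (card (S fin)) _) S+T′≤T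
    where
    s = proj₁ (invariant-run run invariant-init)
    r = proj₂ (invariant-run run invariant-init)
    ℓ = proj₁ (Settled.settled-activated s)
    settled = proj₂ (Settled.settled-activated s)

theorem3 : (𝒢 : Graph → Set) → Hereditary 𝒢 → TSSOptimal 𝒢 → MTSOptimal 𝒢
theorem3 𝒢 hereditary tss-optimal G G∈𝒢 t = MTS.mts-optimal G t λ f f-injective →
  tss-optimal (G ⟨ f ⟩) (hereditary G (G ⟨ f ⟩) G∈𝒢 (⟨⟩-induced G f f-injective))
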